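{- Let $CC$ be a C-system, $Y$ an object of length $n$, $X$ an object of length $m+1$, and $f:Y\to ft(X)$ a morphism. Define $(f,i)^*(X)$ for $0\le i\le m$ inductively by $(f,0)^*(X)=T_n(Y,X)$ and $(f,i+1)^*(X)=S(s_{i+1}(f),(f,i)^*(X))$ (operations of $uB(CC)$). Then $f^*X=(f,m)^*(X)$.
   Context: C-systems: a C0-system is a category $CC$ with a function $l:Ob(CC)\to\mathbb{N}$, an object $pt$, a function $ft:Ob\to Ob$, morphisms $p_X:X\to ft(X)$, and for $l(X)>0$, $f:Y\to ft(X)$ an object $f^*X$ and morphism $q(f,X):f^*X\to X$, such that: $pt$ is the only object of length $0$; $l(ftX)=l(X)-1$ for $l(X)>0$, $ft(pt)=pt$; $pt$ is final; $l(f^*X)>0$, $ft(f^*X)=Y$, $p_X\circ q(f,X)=f\circ p_{f^*X}$ and this square is a pullback; $(id_{ftX})^*X=X$, $q(id,X)=id_X$; $(f\circ g)^*X=g^*(f^*X)$, $q(f\circ g,X)=q(f,X)\circ q(g,f^*X)$. A C-system is a C0-system with, for every $f:Y\to X$ with $l(X)>0$, a morphism $s_f:Y\to(ft(f))^*X$, $ft(f):=p_X\circ f$, with $p_{(ftf)^*X}\circ s_f=id_Y$, $q(ftf,X)\circ s_f=f$, and $s_f=s_{q(g,U)\circ f}$ whenever $X=g^*U$ with $g:ft(X)\to ft(U)$. $uB(CC)$: $B_k=\{V\mid l(V)=k\}$; $\widetilde B_{k+1}=\{(V,t)\mid l(V)=k+1,\ t:ft(V)\to V,\ p_V\circ t=id\}$;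 $\partial(V,t)=V$. For $f:Y\to ft^i(V)$: $f^*(V,0)=Y$, $q(f,V,0)=f$, $f^*(V,i+1)=q(f,ftV,i)^*V$, $q(f,V,i+1)=q(q(f,ftV,i),V)$. For $m'\ge n'\ge0$: $T(Y',V)=p_{Y'}^*(V,m'+1-n')$ for $Y'\in B_{n'+1}$, $V\in B_{m'+1}$, $ft(Y')=ft^{m'+1-n'}(V)$; $S((Z,u),V)=u^*(V,m'+1-n')$ for $(Z,u)\in\widetilde B_{n'+1}$, $V\in B_{m'+2}$, $Z=ft^{m'+1-n'}(V)$. Iterated weakening: $T_0(Y',V)=V$, $T_j(Y',V)=T(Y',T_{j-1}(ft(Y'),V))$ for $j>0$ (defined for $Y'\in B_{n'+j}$, $V\in B_{m'+1}$, $ft^j(Y')=ft^{m'+1-n'}(V)$, $m'\ge n'$). For a morphism $f:Y\to X'$ with $l(Y)=n$, $l(X')=k$, the sequence $(s_1(f),\dots,s_k(f))$ in $\widetilde B_{n+1}$ is empty if $k=0$, and for $k\ge1$ equals $(s_1(ft(f)),\dots,s_{k-1}(ft(f)),((ft(f))^*X',s_f))$ with $ft(f)=p_{X'}\circ f$. -}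

module Defs where

open import Data.Nat using (ℕ; zero; suc; _+_; _∸_; _≤_; _<_)
open import Data.Product using (Σ; _×_; _,_)
open import Data.Vec using (Vec; []; _∷ʳ_; lookup)
open import Data.Fin using (fromℕ<)
open import Relation.Binary.PropositionalEquality using (_≡_; subst; sym)

-- Objects and morphisms form sets: Agda's default (with K) gives UIP for _≡_.

record CSystem : Set₁ where
  infixr 9 _∘_
  field
    Ob  : Set
    Hom : Ob → Ob → Set
    id  : ∀ {X} → Hom X X
    _∘_ : ∀ {X Y Z} → Hom Y Z → Hom X Y → Hom X Z
    idˡ : ∀ {X Y} (f : Hom X Y) → id ∘ f ≡ f
    idʳ : ∀ {X Y} (f : Hom X Y) → f ∘ id ≡ f
    assoc : ∀ {W X Y Z} (h : Hom Y Z) (g : Hom X Y) (f : Hom W X) →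
            (h ∘ g) ∘ f ≡ h ∘ (g ∘ f)
    l  : Ob → ℕ
    pt : Ob
    ft : Ob → Ob
    p  : (X : Ob) → Hom X (ft X)
    -- f^*X (only constrained when l X > 0)
    pb : ∀ {Y} (X : Ob) → Hom Y (ft X) → Ob
    q  : ∀ {Y} (X : Ob) (f : Hom Y (ft X)) → Hom (pb X f) X
    l-pt     : l pt ≡ 0
    pt-only  : ∀ X → l X ≡ 0 → X ≡ pt
    l-ft     : ∀ X → 0 < l X → suc (l (ft X)) ≡ l X
    ft-pt    : ft pt ≡ pt
    pt-final : ∀ X → Σ (Hom X pt) (λ h → ∀ g → g ≡ h)
    l-pb     : ∀ X → 0 < l X → ∀ {Y} (f : Hom Y (ft X)) → 0 < l (pb X f)
    ft-pb    : ∀ X → 0 < l X → ∀ {Y} (f : Hom Y (ft X)) → ft (pb X f) ≡ Y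
    square   : ∀ X (pos : 0 < l X) {Y} (f : Hom Y (ft X)) →
               p X ∘ q X f ≡ f ∘ subst (Hom (pb X f)) (ft-pb X pos f) (p (pb X f))
    pullback : ∀ X (pos : 0 < l X) {Y} (f : Hom Y (ft X)) {Z}
               (a : Hom Z X) (b : Hom Z Y) → p X ∘ a ≡ f ∘ b →
               Σ (Hom Z (pb X f)) (λ h →
                 (q X f ∘ h ≡ a) ×
                 (subst (Hom (pb X f)) (ft-pb X pos f) (p (pb X f)) ∘ h ≡ b) ×
                 (∀ h' → q X f ∘ h' ≡ a →
                   subst (Hom (pb X f)) (ft-pb X pos f) (p (pb X f)) ∘ h' ≡ b →
                   h' ≡ h))
    pb-id    : ∀ X → 0 < l X → pb X (id {ft X}) ≡ X
    q-id     : ∀ X (pos : 0 < l X) →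
               subst (λ W → Hom W X) (pb-id X pos) (q X id) ≡ id
    pb-comp  : ∀ X (pos : 0 < l X) {Y Z} (f : Hom Y (ft X)) (g : Hom Z Y) →
               pb X (f ∘ g) ≡ pb (pb X f) (subst (Hom Z) (sym (ft-pb X pos f)) g)
    q-comp   : ∀ X (pos : 0 < l X) {Y Z} (f : Hom Y (ft X)) (g : Hom Z Y) →
               subst (λ W → Hom W X) (pb-comp X pos f g) (q X (f ∘ g)) ≡
               q X f ∘ q (pb X f) (subst (Hom Z) (sym (ft-pb X pos f)) g)
    -- C-system structure: s_f : Y → (ft f)^* X, where ft f = p X ∘ f
    s      : ∀ {Y X} (f : Hom Y X) → Hom Y (pb X (p X ∘ f))
    s-sec  : ∀ {Y X} (pos : 0 < l X) (f : Hom Y X) →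
             subst (Hom (pb X (p X ∘ f))) (ft-pb X pos (p X ∘ f)) (p (pb X (p X ∘ f))) ∘ s f ≡ id
    s-q    : ∀ {Y X} (pos : 0 < l X) (f : Hom Y X) → q X (p X ∘ f) ∘ s f ≡ f
    -- s_f = s_{q(g,U) ∘ f} whenever X = g^*U (the two codomains are equal
    -- objects; any proof e of this equality may be used for the transport)
    s-nat  : ∀ U (pos : 0 < l U) {W} (g : Hom W (ft U)) {Y} (f : Hom Y (pb U g))
             (e : pb (pb U g) (p (pb U g) ∘ f) ≡ pb U (p U ∘ (q U g ∘ f))) →
             subst (Hom Y) e (s f) ≡ s (q U g ∘ f)

module uB (C : CSystem) where
  open CSystem C

  ft^ : ℕ → Ob → Ob
  ft^ zero    V = V
  ft^ (suc i) V = ft^ i (ft V)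

  mutual
    pbi : (V : Ob) (i : ℕ) {Y : Ob} → Hom Y (ft^ i V) → Ob
    pbi V zero    {Y} f = Y
    pbi V (suc i)     f = pb V (qi (ft V) i f)

    qi : (V : Ob) (i : ℕ) {Y : Ob} (f : Hom Y (ft^ i V)) → Hom (pbi V i f) V
    qi V zero    f = f
    qi V (suc i) f = q V (qi (ft V) i f)

  -- an element (V,t) of \tilde B: object V, the domain D of t (which must
  -- be ft V), and t : D → V
  record Tilde : Set where
    constructor tilde
    field
      obj : Ob
      dom : Ob
      sec : Hom dom obj

  -- "T(Y',V) is defined (for parameters n' m') and equals W"
  TR : (n' m' : ℕ) (Y' V W : Ob) → Set
  TR n' m' Y' V W =
    n' ≤ m' × l Y' ≡ suc n' × l V ≡ suc m' ×
    Σ (ft Y' ≡ ft^ (suc m' ∸ n') V) (λ e →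
      W ≡ pbi V (suc m' ∸ n') (subst (Hom Y') e (p Y')))

  -- "S((Z,u),V) is defined (for parameters n' m') and equals W"
  SR : (n' m' : ℕ) (Zu : Tilde) (V W : Ob) → Set
  SR n' m' (tilde Z D u) V W =
    n' ≤ m' × l Z ≡ suc n' × l V ≡ suc (suc m') ×
    Σ (D ≡ ft Z) (λ d → p Z ∘ u ≡ subst (λ A → Hom A (ft Z)) (sym d) id) ×
    Σ (Z ≡ ft^ (suc m' ∸ n') V) (λ e →
      W ≡ pbi V (suc m' ∸ n') (subst (Hom D) e u))

  -- "T_j(Y',V) is defined (for parameters n' m') and equals W"
  TjR : (n' m' j : ℕ) (Y' V W : Ob) → Set
  TjR n' m' zero    Y' V W = W ≡ V
  TjR n' m' (suc j) Y' V W =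
    Σ Ob (λ U → TjR n' m' j (ft Y') V U × TR (n' + j) (m' + j) Y' U W)

  -- (s_1(f), …, s_k(f)) for f : Y → X' with l X' = k
  sVec : (k : ℕ) {Y X' : Ob} → Hom Y X' → Vec Tilde k
  sVec zero    f = []
  sVec (suc k) {Y} {X'} f =
    sVec k (p X' ∘ f) ∷ʳ tilde (pb X' (p X' ∘ f)) Y (s f)

  -- "(f,i)^*(X) is defined and equals W", for Y of length n, X of length m+1,
  -- f : Y → ft X
  FR : (n m : ℕ) (Y X : Ob) (f : Hom Y (ft X)) (i : ℕ) (W : Ob) → Set
  FR n m Y X f zero    W = TjR 0 m n Y X W
  FR n m Y X f (suc i) W =
    Σ Ob (λ U → FR n m Y X f i U ×
      Σ (i < m) (λ lt →
        SR n (n + (m ∸ suc i)) (lookup (sVec m f) (fromℕ< lt)) U W))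

module Submission where

-- Write pbi V K t for the K-fold iterated pullback f^*(V,K) and, for
-- d ≤ m, X[d] = pbi X (d+1) (ft^d f), where ft^d f : Y → ft^(d+1) X is f
-- followed by d projections.  Then X[0] = f^*X, and we show by induction
-- on i that (f,i)^*X exists and equals X[m ∸ i].  Two facts about iterated
-- pullbacks carry the argument:
--   * functoriality (pbi-id, pbi-comp): iterated pullback along a then b is
--     iterated pullback along a ∘ b; since ft^(m+1) X = pt is final, every
--     T_j(Y',X) is X pulled back along the unique map Y' → pt, hence
--     (f,0)^*X = X[m];
--   * sections (pbi-section): pulling X[d+1] back along the section
--     s_(ft^d f), at the right level, gives X[d]; this is (f,i+1)^*X.

open import Defs
open import Data.Nat using (ℕ; zero; suc; _+_; _∸_; _≤_; _<_; z≤n; s≤s)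
open import Data.Nat.Properties
open import Data.Product using (Σ; _×_; _,_; proj₁; proj₂)
open import Data.Vec using (Vec; []; _∷_; _∷ʳ_; lookup)
open import Data.Fin using (fromℕ<)
open import Relation.Binary.PropositionalEquality
open import Relation.Binary.PropositionalEquality.Properties using (subst-sym-subst)

lookup-∷ʳ-init : ∀ {A : Set} {k} (xs : Vec A k) x i (i<1+k : i < suc k) (i<k : i < k) →
                 lookup (xs ∷ʳ x) (fromℕ< i<1+k) ≡ lookup xs (fromℕ< i<k)
lookup-∷ʳ-init (y ∷ xs) x zero    _           _         = refl
lookup-∷ʳ-init (y ∷ xs) x (suc i) (s≤s i<1+k) (s≤s i<k) = lookup-∷ʳ-init xs x i i<1+k i<k

lookup-∷ʳ-last : ∀ {A : Set} {k} (xs : Vec A k) x i (i<1+k : i < suc k) → i ≡ k →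
                 lookup (xs ∷ʳ x) (fromℕ< i<1+k) ≡ x
lookup-∷ʳ-last []       x .0       _           refl = refl
lookup-∷ʳ-last (y ∷ xs) x .(suc _) (s≤s i<1+k) refl = lookup-∷ʳ-last xs x _ i<1+k refl

module IteratedPullbacks (C : CSystem) where
  open CSystem C
  open uB C

  -- Objects over V and under Y.  A pullback is compared together with its
  -- q-morphism, i.e. as an object over V; this is what makes the
  -- inductions on the number of iterations go through.
  Over : Ob → Set
  Over V = Σ Ob (λ A → Hom A V)

  Under : Ob → Set
  Under Y = Σ Ob (Hom Y)

  over-≡ : ∀ {A A' V} (E : A ≡ A') (φ : Hom A V) (ψ : Hom A' V) →
           subst (λ W → Hom W V) E φ ≡ ψ → _≡_ {A = Over V} (A , φ) (A' , ψ)
  over-≡ refl φ .φ refl = refl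

  under-≡-arrow : ∀ {Y B} {x y : Hom Y B} → _≡_ {A = Under Y} (B , x) (B , y) → x ≡ y
  under-≡-arrow refl = refl

  ≤-l-ft : ∀ {k V} → suc k ≤ l V → k ≤ l (ft V)
  ≤-l-ft {k} {V} le = ≤-pred (subst (suc k ≤_) (sym (l-ft V (m<n⇒0<n le))) le)

  l-pullback : ∀ V (pos : 0 < l V) {Y} (f : Hom Y (ft V)) → l (pb V f) ≡ suc (l Y)
  l-pullback V pos f = trans (sym (l-ft (pb V f) (l-pb V pos f))) (cong (λ Z → suc (l Z)) (ft-pb V pos f))

  l-ft^ : ∀ k V → k ≤ l V → l (ft^ k V) + k ≡ l V
  l-ft^ zero    V le = +-identityʳ _
  l-ft^ (suc k) V le =
    trans (+-suc _ k) (trans (cong suc (l-ft^ k (ft V) (≤-l-ft le))) (l-ft V (m<n⇒0<n le)))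

  l-pbi : ∀ K V {A} (t : Hom A (ft^ K V)) → K ≤ l V → l (pbi V K t) ≡ l A + K
  l-pbi zero    V t le = sym (+-identityʳ _)
  l-pbi (suc K) V {A} t le = begin
    l (pb V (qi (ft V) K t))  ≡⟨ l-pullback V (m<n⇒0<n le) (qi (ft V) K t) ⟩
    suc (l (pbi (ft V) K t))  ≡⟨ cong suc (l-pbi K (ft V) t (≤-l-ft le)) ⟩
    suc (l A + K)             ≡⟨ sym (+-suc (l A) K) ⟩
    l A + suc K               ∎
    where open ≡-Reasoning

  ft^-pbi : ∀ K V {A} (t : Hom A (ft^ K V)) → K ≤ l V → ft^ K (pbi V K t) ≡ A
  ft^-pbi zero    V t le = refl
  ft^-pbi (suc K) V t le =
    trans (cong (ft^ K) (ft-pb V (m<n⇒0<n le) (qi (ft V) K t))) (ft^-pbi K (ft V) t (≤-l-ft le))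

  ft^-pbi-suc : ∀ k V → k < l V → ∀ {Y} (h : Hom Y (ft^ k V)) (g : Hom Y (ft^ (suc k) V)) →
                _≡_ {A = Under Y} (ft^ (suc k) V , g) (ft (ft^ k V) , p _ ∘ h) →
                ft^ k (pbi V (suc k) g) ≡ pb (ft^ k V) (p _ ∘ h)
  ft^-pbi-suc zero    V lt h g g≡ph = cong (pb V) (under-≡-arrow g≡ph)
  ft^-pbi-suc (suc k) V lt h g g≡ph =
    trans (cong (ft^ k) (ft-pb V (m<n⇒0<n lt) (qi (ft V) (suc k) g)))
          (ft^-pbi-suc k (ft V) (≤-l-ft lt) h g g≡ph)

  proj^ : ∀ d {Y X'} → Hom Y X' → Hom Y (ft^ d X')
  proj^ zero    f = f
  proj^ (suc d) {X' = X'} f = proj^ d (p X' ∘ f)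

  proj^-suc : ∀ d {Y X'} (f : Hom Y X') →
              _≡_ {A = Under Y} (ft^ (suc d) X' , proj^ (suc d) f) (ft (ft^ d X') , p _ ∘ proj^ d f)
  proj^-suc zero    f = refl
  proj^-suc (suc d) {X' = X'} f = proj^-suc d (p X' ∘ f)

  -- Objects of length 0 equal pt, so they are final: there is a map into
  -- them, and any two are equal.
  into-length0-unique : ∀ {A B} → l B ≡ 0 → (a b : Hom A B) → a ≡ b
  into-length0-unique {A} {B} lB a b = unique (pt-only B lB) a b
    where unique : ∀ {B} → B ≡ pt → (a b : Hom A B) → a ≡ b
          unique refl a b = trans (proj₂ (pt-final A) a) (sym (proj₂ (pt-final A) b))

  into-length0 : ∀ {A B} → l B ≡ 0 → Hom A B
  into-length0 {A} {B} lB = subst (Hom A) (sym (pt-only B lB)) (proj₁ (pt-final A))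

  pullback-over : ∀ V → Over (ft V) → Over V
  pullback-over V (A , t) = pb V t , q V t

  postcompose : ∀ {U V} → Hom U V → Over U → Over V
  postcompose Q (A , t) = A , Q ∘ t

  pb-comp-over : ∀ V (pos : 0 < l V) {U} (Q : Hom U (ft V)) {R} (r : Hom R (ft (pb V Q))) →
                 _≡_ {A = Over V} (pb (pb V Q) r , q V Q ∘ q (pb V Q) r)
                                  (pullback-over V (R , Q ∘ subst (Hom R) (ft-pb V pos Q) r))
  pb-comp-over V pos Q {R} r = sym (trans
    (over-≡ (pb-comp V pos Q r') _ _ (q-comp V pos Q r'))
    (cong (λ r₀ → (pb (pb V Q) r₀ , q V Q ∘ q (pb V Q) r₀)) (subst-sym-subst (ft-pb V pos Q))))
    where r' = subst (Hom R) (ft-pb V pos Q) r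

  pbi-cong : ∀ {A B} (E : A ≡ B) k {Y Z} (e₁ : Z ≡ ft^ k A) (e₂ : Z ≡ ft^ k B) (u : Hom Y Z) →
             _≡_ {A = Over B}
               (pbi A k (subst (Hom Y) e₁ u) , subst (Hom (pbi A k (subst (Hom Y) e₁ u))) E (qi A k (subst (Hom Y) e₁ u)))
               (pbi B k (subst (Hom Y) e₂ u) , qi B k (subst (Hom Y) e₂ u))
  pbi-cong refl k refl refl u = refl

  pbi-id : ∀ K V → K ≤ l V → _≡_ {A = Over V} (pbi V K id , qi V K id) (V , id)
  pbi-id zero    V le = refl
  pbi-id (suc K) V le =
    trans (cong (pullback-over V) (pbi-id K (ft V) (≤-l-ft le)))
          (over-≡ (pb-id V (m<n⇒0<n le)) _ _ (q-id V (m<n⇒0<n le)))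

  pbi-comp : ∀ K V → K ≤ l V → ∀ {A B} (a : Hom A (ft^ K V)) (b : Hom B A) (e : A ≡ ft^ K (pbi V K a)) →
             _≡_ {A = Over V}
               (pbi (pbi V K a) K (subst (Hom B) e b) , qi V K a ∘ qi (pbi V K a) K (subst (Hom B) e b))
               (pbi V K (a ∘ b) , qi V K (a ∘ b))
  pbi-comp zero    V le a b refl = refl
  pbi-comp (suc K) V le {A} {B} a b e =
    trans (pb-comp-over V pos Q r)
          (cong (pullback-over V) (trans (cong (postcompose Q) (pbi-cong E K e e' b))
                                         (pbi-comp K (ft V) (≤-l-ft le) a b e')))
    where pos = m<n⇒0<n le
          Q = qi (ft V) K a
          E = ft-pb V pos Q
          e' = trans e (cong (ft^ K) E)
          r = qi (ft (pb V Q)) K (subst (Hom B) e b)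

  -- The
  -- base case is the axiom q(p ∘ h) ∘ s_h = h, the step is pb-comp-over.
  pbi-section : ∀ k V → k < l V → ∀ {Y} (h : Hom Y (ft^ k V)) (g : Hom Y (ft^ (suc k) V)) →
                _≡_ {A = Under Y} (ft^ (suc k) V , g) (ft (ft^ k V) , p _ ∘ h) →
                (e : pb (ft^ k V) (p _ ∘ h) ≡ ft^ k (pbi V (suc k) g)) →
                _≡_ {A = Over V}
                  (pbi (pbi V (suc k) g) k (subst (Hom Y) e (s h)) ,
                   qi V (suc k) g ∘ qi (pbi V (suc k) g) k (subst (Hom Y) e (s h)))
                  (pbi V k h , qi V k h)
  pbi-section zero V lt {Y} h g g≡ph e = cong (Y ,_) (q∘s (under-≡-arrow g≡ph) e)
    where q∘s : ∀ {g} → g ≡ p V ∘ h → (e : pb V (p V ∘ h) ≡ pb V g) → q V g ∘ subst (Hom Y) e (s h) ≡ h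
          q∘s refl refl = s-q (m<n⇒0<n lt) h
  pbi-section (suc k) V lt {Y} h g g≡ph e =
    trans (pb-comp-over V pos Q r)
          (cong (pullback-over V) (trans (cong (postcompose Q) (pbi-cong E k e e' (s h)))
                                         (pbi-section k (ft V) (≤-l-ft lt) h g g≡ph e')))
    where pos = m<n⇒0<n lt
          Q = qi (ft V) (suc k) g
          E = ft-pb V pos Q
          e' = trans e (cong (ft^ k) E)
          r = qi (ft (pb V Q)) k (subst (Hom Y) e (s h))

  -- Pulling back along a map between objects of length 0 changes nothing:
  -- such a map is the identity of pt.
  pbi-length0 : ∀ K V {A} (t : Hom A (ft^ K V)) → K ≤ l V → l A ≡ 0 → l (ft^ K V) ≡ 0 → pbi V K t ≡ V
  pbi-length0 K V {A} t le lA lB = by-id (trans (pt-only A lA) (sym (pt-only _ lB))) t (into-length0-unique lB t _)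
    where by-id : ∀ {A} (E : A ≡ ft^ K V) (t : Hom A (ft^ K V)) →
                  t ≡ subst (λ Z → Hom Z (ft^ K V)) (sym E) id → pbi V K t ≡ V
          by-id refl t refl = cong proj₁ (pbi-id K V le)

  -- The section axiom p ∘ s = id, in the form demanded by S.
  section-of-p : ∀ Z {Y} (E : ft Z ≡ Y) (t : Hom Y Z) → subst (Hom Z) E (p Z) ∘ t ≡ id →
                 p Z ∘ t ≡ subst (λ A → Hom A (ft Z)) (sym (sym E)) id
  section-of-p Z refl t p∘t≡id = p∘t≡id

  -- The (i+1)-st entry of (s_1(f), …, s_k(f)), where k = i+1+d, is the
  -- section of ft^d f.
  sVec-lookup : ∀ k i d → k ≡ suc (i + d) → ∀ {Y X'} (f : Hom Y X') (lt : i < k) →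
                lookup (sVec k f) (fromℕ< lt) ≡ tilde (pb (ft^ d X') (p _ ∘ proj^ d f)) Y (s (proj^ d f))
  sVec-lookup (suc k) i zero k≡ {X' = X'} f lt =
    lookup-∷ʳ-last (sVec k (p X' ∘ f)) _ i lt (trans (sym (+-identityʳ i)) (sym (suc-injective k≡)))
  sVec-lookup (suc k) i (suc d) k≡ {X' = X'} f lt =
    trans (lookup-∷ʳ-init (sVec k (p X' ∘ f)) _ i lt lt') (sVec-lookup k i d k≡' (p X' ∘ f) lt')
    where k≡' = trans (suc-injective k≡) (+-suc i d)
          lt' = subst (i <_) (sym k≡') (s≤s (m≤m+n i d))

module PullbackByWeakeningAndSubstitution (C : CSystem) (n m : ℕ) (Y X : CSystem.Ob C)
  (lY : CSystem.l C Y ≡ n) (lX : CSystem.l C X ≡ suc m) (f : CSystem.Hom C Y (CSystem.ft C X)) where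
  open CSystem C
  open uB C
  open IteratedPullbacks C

  m<lX : m < l X
  m<lX = subst (m <_) (sym lX) ≤-refl

  l-ft^m+1 : l (ft^ m (ft X)) ≡ 0
  l-ft^m+1 = +-cancelʳ-≡ (suc m) _ 0 (trans (l-ft^ (suc m) X m<lX) lX)

  ! : ∀ {A} → Hom A (ft^ m (ft X))
  ! = into-length0 l-ft^m+1

  l-ft-of-suc : ∀ {Y' j} → l Y' ≡ suc j → l (ft Y') ≡ j
  l-ft-of-suc {Y'} lY' = suc-injective (trans (l-ft Y' (subst (0 <_) (sym lY') (s≤s z≤n))) lY')

  -- Weakening T(Y', U) of U = X pulled back along ! : ft Y' → pt is X
  -- pulled back along any t : Y' → pt (functoriality, then uniqueness of t).
  T-unique : ∀ {Y'} (t : Hom Y' (ft^ m (ft X))) K → K ≡ suc m → ∀ U W (e : ft Y' ≡ ft^ K U) →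
             W ≡ pbi U K (subst (Hom Y') e (p Y')) → U ≡ pbi X (suc m) (! {ft Y'}) → W ≡ pbi X (suc m) t
  T-unique {Y'} t .(suc m) refl .(pbi X (suc m) !) W e W≡ refl =
    trans W≡ (trans (cong proj₁ (pbi-comp (suc m) X m<lX ! (p Y') e))
                    (cong (pbi X (suc m)) (into-length0-unique l-ft^m+1 _ t)))

  Tj-unique : ∀ j Y' W → l Y' ≡ j → TjR 0 m j Y' X W → (t : Hom Y' (ft^ m (ft X))) → W ≡ pbi X (suc m) t
  Tj-unique zero    Y' .X lY' refl t = sym (pbi-length0 (suc m) X t m<lX lY' l-ft^m+1)
  Tj-unique (suc j) Y' W lY' (U , Tj , (_ , _ , _ , e , W≡)) t =
    T-unique t (suc (m + j) ∸ j) (m+n∸n≡m (suc m) j) U W e W≡ (Tj-unique j (ft Y') U (l-ft-of-suc lY') Tj !)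

  T-exists : ∀ j Y' U → l Y' ≡ suc j → U ≡ pbi X (suc m) (! {ft Y'}) → Σ Ob (TR j (m + j) Y' U)
  T-exists j Y' .(pbi X (suc m) !) lY' refl =
    pbi U K (subst (Hom Y') e (p Y')) , m≤n+m j m , lY' , lU , e , refl
    where U = pbi X (suc m) (! {ft Y'})
          K = suc (m + j) ∸ j
          lU : l U ≡ suc (m + j)
          lU = trans (l-pbi (suc m) X ! m<lX)
                     (trans (cong (_+ suc m) (l-ft-of-suc lY')) (trans (+-suc j m) (cong suc (+-comm j m))))
          e : ft Y' ≡ ft^ K U
          e = subst (λ K → ft Y' ≡ ft^ K U) (sym (m+n∸n≡m (suc m) j)) (sym (ft^-pbi (suc m) X ! m<lX))

  Tj-exists : ∀ j Y' → l Y' ≡ j → Σ Ob (TjR 0 m j Y' X)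
  Tj-exists zero    Y' lY' = X , refl
  Tj-exists (suc j) Y' lY' with Tj-exists j (ft Y') (l-ft-of-suc lY')
  ... | U , Tj with T-exists j Y' U lY' (Tj-unique j (ft Y') U (l-ft-of-suc lY') Tj !)
  ... | W , T = W , U , Tj , T

  X[_] : ℕ → Ob
  X[ d ] = pbi X (suc d) (proj^ d f)

  -- The object of the section s_(ft^d f), i.e. of s_(i+1)(f) when i+1+d = m.
  Z[_] : ℕ → Ob
  Z[ d ] = pb (ft^ d (ft X)) (p _ ∘ proj^ d f)

  m∸1+i : ∀ i d → suc (i + d) ≡ m → m ∸ suc i ≡ d
  m∸1+i i d 1+i+d≡m = trans (cong (_∸ suc i) (sym 1+i+d≡m)) (m+n∸m≡n i d)

  S-level : ∀ i d → suc (i + d) ≡ m → suc (n + (m ∸ suc i)) ∸ n ≡ suc d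
  S-level i d 1+i+d≡m =
    trans (cong (_∸ n) (sym (+-suc n (m ∸ suc i))))
          (trans (m+n∸m≡n n (suc (m ∸ suc i))) (cong suc (m∸1+i i d 1+i+d≡m)))

  d<m : ∀ i d → suc (i + d) ≡ m → d < m
  d<m i d 1+i+d≡m = subst (d <_) 1+i+d≡m (s≤s (m≤n+m d i))

  1+d<lX : ∀ {d} → d < m → suc d < l X
  1+d<lX {d} lt = subst (suc d <_) (sym lX) (s≤s lt)

  S-unique : ∀ i d → suc (i + d) ≡ m → ∀ U W →
             SR n (n + (m ∸ suc i)) (tilde Z[ d ] Y (s (proj^ d f))) U W → U ≡ X[ suc d ] → W ≡ X[ d ]
  S-unique i d 1+i+d≡m U W (_ , _ , _ , _ , e , W≡) U≡ =
    by-section (suc (n + (m ∸ suc i)) ∸ n) (S-level i d 1+i+d≡m) U e W≡ U≡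
    where by-section : ∀ K → K ≡ suc d → ∀ U (e : Z[ d ] ≡ ft^ K U) →
                       W ≡ pbi U K (subst (Hom Y) e (s (proj^ d f))) → U ≡ X[ suc d ] → W ≡ X[ d ]
          by-section .(suc d) refl .(X[ suc d ]) e W≡ refl =
            trans W≡ (cong proj₁ (pbi-section (suc d) X (1+d<lX (d<m i d 1+i+d≡m))
                                              (proj^ d f) (proj^ (suc d) f) (proj^-suc d f) e))

  S-exists : ∀ i d → suc (i + d) ≡ m → ∀ U → U ≡ X[ suc d ] →
             Σ Ob (SR n (n + (m ∸ suc i)) (tilde Z[ d ] Y (s (proj^ d f))) U)
  S-exists i d 1+i+d≡m .(X[ suc d ]) refl =
    pbi U K (subst (Hom Y) e (s h)) , m≤m+n n _ , l-Z , l-U ,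
    (sym E , section-of-p Z[ d ] E (s h) (s-sec B>0 h)) , e , refl
    where U = X[ suc d ]
          K = suc (n + (m ∸ suc i)) ∸ n
          h = proj^ d f
          B = ft^ d (ft X)
          2+d≤lX = 1+d<lX (d<m i d 1+i+d≡m)
          l-B : l B ≡ suc i
          l-B = +-cancelʳ-≡ (suc d) _ _ (trans (l-ft^ (suc d) X (<⇒≤ 2+d≤lX))
                  (trans lX (cong suc (trans (sym 1+i+d≡m) (sym (+-suc i d))))))
          B>0 : 0 < l B
          B>0 = subst (0 <_) (sym l-B) (s≤s z≤n)
          E = ft-pb B B>0 (p B ∘ h)
          l-Z : l Z[ d ] ≡ suc n
          l-Z = trans (l-pullback B B>0 (p B ∘ h)) (cong suc lY)
          l-U : l U ≡ suc (suc (n + (m ∸ suc i)))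
          l-U = begin
            l U                       ≡⟨ l-pbi (suc (suc d)) X (proj^ (suc d) f) 2+d≤lX ⟩
            l Y + suc (suc d)         ≡⟨ cong (_+ suc (suc d)) lY ⟩
            n + suc (suc d)           ≡⟨ trans (+-suc n (suc d)) (cong suc (+-suc n d)) ⟩
            suc (suc (n + d))         ≡⟨ cong (λ x → suc (suc (n + x))) (sym (m∸1+i i d 1+i+d≡m)) ⟩
            suc (suc (n + (m ∸ suc i))) ∎
            where open ≡-Reasoning
          e : Z[ d ] ≡ ft^ K U
          e = subst (λ K → Z[ d ] ≡ ft^ K U) (sym (S-level i d 1+i+d≡m))
                (sym (ft^-pbi-suc (suc d) X 2+d≤lX h (proj^ (suc d) f) (proj^-suc d f)))

  F-unique : ∀ i d → i + d ≡ m → ∀ W → FR n m Y X f i W → W ≡ X[ d ]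
  F-unique zero    d d≡m W F = trans (Tj-unique n Y W lY F (proj^ m f)) (cong X[_] (sym d≡m))
  F-unique (suc i) d 1+i+d≡m W (U , F , lt , S) =
    S-unique i d 1+i+d≡m U W (subst (λ t → SR n (n + (m ∸ suc i)) t U W) (sVec-lookup m i d (sym 1+i+d≡m) f lt) S)
      (F-unique i (suc d) (trans (+-suc i d) 1+i+d≡m) U F)

  F-exists : ∀ i → i ≤ m → Σ Ob (FR n m Y X f i)
  F-exists zero    _  = Tj-exists n Y lY
  F-exists (suc i) lt with F-exists i (<⇒≤ lt)
  ... | U , F with S-exists i (m ∸ suc i) (m+[n∸m]≡n lt) U
                    (F-unique i (suc (m ∸ suc i)) (trans (+-suc i (m ∸ suc i)) (m+[n∸m]≡n lt)) U F)
  ... | W , S = W , U , F , lt ,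
        subst (λ t → SR n (n + (m ∸ suc i)) t U W) (sym (sVec-lookup m i (m ∸ suc i) (sym (m+[n∸m]≡n lt)) f lt)) S

lemma2p13 : (C : CSystem) (n m : ℕ) (Y X : CSystem.Ob C) →
            CSystem.l C Y ≡ n → CSystem.l C X ≡ suc m →
            (f : CSystem.Hom C Y (CSystem.ft C X)) →
            Σ (CSystem.Ob C) (uB.FR C n m Y X f m) ×
            (∀ W → uB.FR C n m Y X f m W → W ≡ CSystem.pb C X f)
lemma2p13 C n m Y X lY lX f = F-exists m ≤-refl , F-unique m 0 (+-identityʳ m)
  where open PullbackByWeakeningAndSubstitution C n m Y X lY lX f
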